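{- Let $\beta,\gamma$ be integers with $\beta\ge1$ and $\gamma\ge2$. Then the system of congruences $s\equiv -1\pmod{3^\beta}$, $s\equiv 1\pmod{2^\gamma}$ has a unique solution $k\in\mathbb{Z}$ with $0<k<3^\beta2^\gamma$. Moreover, let $A$ be the set of primes $p$ with $p\equiv 2\pmod 3$ for which there exist $\alpha',\beta',\gamma'\in\mathbb{N}=\{1,2,\dots\}$ and primes $q,r$ with $\gcd(6,qr)=1$ such that $p+1=2^{\alpha'}3^{\beta'} q$ and $p-1=2^{\gamma'} r$. If $p\in A$ with $p+1=2\cdot3^\beta q$ and $p-1=2^\gamma r$ for primes $q,r$ coprime to $6$ (i.e. the case $\alpha=1$), then $p=3^\beta2^\gamma n+k$ for some $n\in\mathbb{N}_0$, and the corresponding $q,r$ are given by $$q=2^{\gamma-1}n+\frac{k+1}{2\cdot3^\beta},\qquad r=3^\beta n+\frac{k-1}{2^\gamma}.$$ Furthermore, $\frac{k+1}{2\cdot3^\beta}$ is an odd integer and $\frac{k-1}{2^\gamma}$ is an integer not divisible by $3$. -}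

module Defs where

open import Data.Nat using (ℕ; _+_; _*_; _∸_; _^_; _<_; _≤_)
open import Data.Nat.Divisibility using (_∣_)
open import Data.Nat.DivMod using (_%_)
open import Data.Nat.Primality using (Prime)
open import Data.Nat.Coprimality using (Coprime)
open import Data.Product using (_×_; ∃-syntax)
open import Relation.Binary.PropositionalEquality using (_≡_)

-- k solves  s ≡ -1 (mod 3^β),  s ≡ 1 (mod 2^γ)  with 0 < k < 3^β 2^γ.
-- Since k > 0, "k ≡ 1 (mod 2^γ)" is written as 2^γ ∣ k ∸ 1 (truncated
-- subtraction is exact here).
IsSol : ℕ → ℕ → ℕ → Set
IsSol β γ k = (0 < k) × (k < 3 ^ β * 2 ^ γ) × (3 ^ β ∣ k + 1) × (2 ^ γ ∣ k ∸ 1)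

InA : ℕ → Set
InA p = Prime p × (p % 3 ≡ 2) ×
  (∃[ α' ] ∃[ β' ] ∃[ γ' ] ∃[ q ] ∃[ r ]
     (1 ≤ α') × (1 ≤ β') × (1 ≤ γ') × Prime q × Prime r × Coprime 6 (q * r) ×
     (p + 1 ≡ 2 ^ α' * 3 ^ β' * q) × (p ∸ 1 ≡ 2 ^ γ' * r))

{-# OPTIONS --safe #-}
-- 3^β is odd, and squaring an inverse of an odd number modulo 2^γ (Hensel lifting) gives
-- one modulo 2^(γ+1); so 3^β x = 2^γ y + 1 for some x, y. This makes 3^β and 2^γ coprime,
-- and 2·2^γ y + 1 solves both congruences; reducing it modulo 3^β 2^γ gives k, and two
-- solutions in range differ by a multiple of 3^β 2^γ below it. Since 4 ∣ 2^γ, k + 1 =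
-- (k - 1) + 2 is twice an odd number, so the cofactor a of 2·3^β is odd; and 3 ∤ b since 3
-- cannot divide both k - 1 and k + 1. The conditions on p make p another solution, so
-- p = 3^β 2^γ n + k, and q, r are read off by cancelling 2·3^β and 2^γ.
module Submission where

open import Defs
open import Data.Nat using (ℕ; _+_; _*_; _∸_; _^_; _≤_)
open import Data.Nat.Divisibility using (_∣_)
open import Data.Nat.Primality using (Prime)
open import Data.Nat.Coprimality using (Coprime)
open import Data.Product using (Σ; _×_; ∃-syntax)
open import Relation.Binary.PropositionalEquality using (_≡_)
open import Relation.Nullary using (¬_)

open import Data.Nat.Base using (zero; suc; _<_; s≤s; z≤n; z<s; NonZero; >-nonZero)
open import Data.Nat.Properties
open import Data.Nat.Divisibility
  using (divides; ∣m+n∣m⇒∣n; ∣n⇒∣m*n; ∣m⇒∣m*n; m∣m*n; n∣m*n; ∣-trans; ∣1⇒≡1; _∣0; >⇒∤; ∣⇒≤;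
         *-monoʳ-∣)
open import Data.Nat.DivMod using (_/_; _%_; m≡m%n+[m/n]*n; m%n<n)
open import Data.Nat.Coprimality using (coprime-divisor) renaming (sym to ⊥-sym)
open import Data.Nat.Tactic.RingSolver using (solve)
open import Data.List using (_∷_; [])
open import Data.Product using (_,_; proj₁)
open import Data.Sum using (inj₁; inj₂)
open import Relation.Binary.PropositionalEquality
  using (refl; sym; trans; cong; cong₂; subst; module ≡-Reasoning)
open import Relation.Nullary using (contradiction)

∣-∸ : ∀ {d m n} → d ∣ m → d ∣ n → d ∣ m ∸ n
∣-∸ {d} {m} {n} d∣m d∣n with ≤-total n m
... | inj₁ n≤m = ∣m+n∣m⇒∣n (subst (d ∣_) (sym (m+[n∸m]≡n n≤m)) d∣m) d∣n
... | inj₂ m≤n = subst (d ∣_) (sym (m≤n⇒m∸n≡0 m≤n)) (d ∣0)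

∣∧<⇒≡0 : ∀ {m n} → m ∣ n → n < m → n ≡ 0
∣∧<⇒≡0 {n = zero}  _   _   = refl
∣∧<⇒≡0 {n = suc _} m∣n n<m = contradiction m∣n (>⇒∤ n<m)

invertible⇒coprime : ∀ {m n x y} → m * x ≡ n * y + 1 → Coprime m n
invertible⇒coprime {x = x} {y} eq {i} (i∣m , i∣n) =
  ∣1⇒≡1 (∣m+n∣m⇒∣n (subst (i ∣_) eq (∣m⇒∣m*n x i∣m)) (∣m⇒∣m*n y i∣n))

coprime⇒*∣ : ∀ {m n d} → Coprime m n → m ∣ d → n ∣ d → m * n ∣ d
coprime⇒*∣ {m} {n} m⊥n (divides e refl) n∣em =
  subst (m * n ∣_) (*-comm m e) (*-monoʳ-∣ m (coprime-divisor (⊥-sym m⊥n) n∣me))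
  where
  n∣me : n ∣ m * e
  n∣me = subst (n ∣_) (*-comm e m) n∣em

coprime-∣ʳ : ∀ {m n d} → Coprime m n → d ∣ n → Coprime m d
coprime-∣ʳ m⊥n d∣n (i∣m , i∣d) = m⊥n (i∣m , ∣-trans i∣d d∣n)

3^-odd : ∀ β → ∃[ t ] 3 ^ β ≡ 1 + 2 * t
3^-odd zero = 0 , refl
3^-odd (suc β) with t , e ← 3^-odd β =
  1 + 3 * t , trans (cong (3 *_) e) (solve (t ∷ []))

square-inverse-mod-2* : ∀ {m x P y} → m * x ≡ 2 * P * y + 1 →
                         m * (m * x * x) ≡ 2 * (2 * P) * (P * y * y + y) + 1
square-inverse-mod-2* {m} {x} {P} {y} e = begin
  m * (m * x * x)                   ≡⟨ solve (m ∷ x ∷ []) ⟩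
  (m * x) * (m * x)                 ≡⟨ cong₂ _*_ e e ⟩
  (2 * P * y + 1) * (2 * P * y + 1) ≡⟨ solve (P ∷ y ∷ []) ⟩
  2 * (2 * P) * (P * y * y + y) + 1 ∎
  where open ≡-Reasoning

odd-invertible-mod-2^ : ∀ {m} → ∃[ t ] m ≡ 1 + 2 * t → ∀ γ → ∃[ x ] ∃[ y ] m * x ≡ 2 ^ suc γ * y + 1
odd-invertible-mod-2^ (t , refl) zero = 1 , t , solve (t ∷ [])
odd-invertible-mod-2^ {m} m-odd (suc γ) with x , y , e ← odd-invertible-mod-2^ m-odd γ =
  m * x * x , 2 ^ γ * y * y + y , square-inverse-mod-2* {m} {x} {2 ^ γ} e

Solves : ℕ → ℕ → ℕ → Set
Solves B G k = B ∣ k + 1 × G ∣ k ∸ 1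

solves-from-inverse : ∀ {B G x y} → B * x ≡ G * y + 1 → Solves B G (2 * (G * y) + 1)
solves-from-inverse {B} {G} {x} {y} e = divides (2 * x) B∣s+1 , G∣s∸1
  where
  open ≡-Reasoning
  B∣s+1 : 2 * (G * y) + 1 + 1 ≡ 2 * x * B
  B∣s+1 = begin
    2 * (G * y) + 1 + 1 ≡⟨ solve (G ∷ y ∷ []) ⟩
    2 * (G * y + 1)     ≡⟨ cong (2 *_) e ⟨
    2 * (B * x)         ≡⟨ solve (B ∷ x ∷ []) ⟩
    2 * x * B           ∎
  G∣s∸1 : G ∣ 2 * (G * y) + 1 ∸ 1
  G∣s∸1 = subst (G ∣_) (sym (m+n∸n≡m (2 * (G * y)) 1)) (∣n⇒∣m*n 2 (m∣m*n y))

∣+1-cancel : ∀ {d r q} → d ∣ q → d ∣ r + q + 1 → d ∣ r + 1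
∣+1-cancel {d} {r} {q} d∣q d∣r+q+1 =
  ∣m+n∣m⇒∣n (subst (d ∣_) reorder d∣r+q+1) d∣q
  where
  reorder : r + q + 1 ≡ q + (r + 1)
  reorder = solve (r ∷ q ∷ [])

∣∸1-cancel : ∀ {d r q} → 0 < r → d ∣ q → d ∣ r + q ∸ 1 → d ∣ r ∸ 1
∣∸1-cancel {d} {suc r} {q} _ d∣q d∣r+q∸1 = ∣m+n∣m⇒∣n (subst (d ∣_) (+-comm r q) d∣r+q∸1) d∣q

module Residues {B G : ℕ} (1<B : 1 < B) {{_ : NonZero G}} (B⊥G : Coprime B G) where

  instance
    B≢0 : NonZero B
    B≢0 = >-nonZero (<-trans z<s 1<B)

    B*G≢0 : NonZero (B * G)
    B*G≢0 = m*n≢0 B G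

  ∣+1⇒>0 : ∀ {k} → B ∣ k + 1 → 0 < k
  ∣+1⇒>0 {zero}  B∣1 = contradiction (∣1⇒≡1 B∣1) (>⇒≢ 1<B)
  ∣+1⇒>0 {suc _} _   = z<s

  solves-≤ : ∀ {k k′} → Solves B G k → Solves B G k′ → k < B * G → k ≤ k′
  solves-≤ {zero}           _         _           _   = z≤n
  solves-≤ {suc _} {zero}   _         (B∣1 , _)   _   = contradiction (∣+1⇒>0 {0} B∣1) (<-irrefl refl)
  solves-≤ {suc j} {suc j′} (B∣ , G∣) (B∣′ , G∣′) k<M =
    s≤s (m∸n≡0⇒m≤n (∣∧<⇒≡0 (coprime⇒*∣ B⊥G B∣j∸j′ (∣-∸ G∣ G∣′)) j∸j′<M))
    where
    B∣j∸j′ : B ∣ j ∸ j′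
    B∣j∸j′ = subst (B ∣_) (cong₂ _∸_ (+-comm j 1) (+-comm j′ 1)) (∣-∸ B∣ B∣′)
    j∸j′<M : j ∸ j′ < B * G
    j∸j′<M = ≤-<-trans (m∸n≤m j j′) (<-trans (n<1+n j) k<M)

  solves-unique : ∀ {k k′} → Solves B G k → Solves B G k′ → k < B * G → k′ < B * G → k ≡ k′
  solves-unique s s′ k<M k′<M = ≤-antisym (solves-≤ s s′ k<M) (solves-≤ s′ s k′<M)

  solves-% : ∀ {s} → Solves B G s → Solves B G (s % (B * G))
  solves-% {s} (B∣ , G∣) =
    B∣r+1 , ∣∸1-cancel (∣+1⇒>0 B∣r+1) (∣n⇒∣m*n q (n∣m*n B)) (subst (λ x → G ∣ x ∸ 1) s≡r+qM G∣)
    where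
    q = s / (B * G)
    s≡r+qM : s ≡ s % (B * G) + q * (B * G)
    s≡r+qM = m≡m%n+[m/n]*n s (B * G)
    B∣r+1 : B ∣ s % (B * G) + 1
    B∣r+1 = ∣+1-cancel (∣n⇒∣m*n q (m∣m*n G)) (subst (λ x → B ∣ x + 1) s≡r+qM B∣)

  solves⇒≡mod : ∀ {k s} → Solves B G k → k < B * G → Solves B G s → s ≡ B * G * (s / (B * G)) + k
  solves⇒≡mod {k} {s} sk k<M ss = begin
    s                                   ≡⟨ m≡m%n+[m/n]*n s (B * G) ⟩
    s % (B * G) + s / (B * G) * (B * G) ≡⟨ cong₂ _+_ s%M≡k (*-comm (s / (B * G)) (B * G)) ⟩
    k + B * G * (s / (B * G))           ≡⟨ +-comm k _ ⟩
    B * G * (s / (B * G)) + k           ∎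
    where
    open ≡-Reasoning
    s%M≡k : s % (B * G) ≡ k
    s%M≡k = solves-unique (solves-% ss) sk (m%n<n s (B * G)) k<M

+1≡∸1+2 : ∀ {k} → 0 < k → k + 1 ≡ k ∸ 1 + 2
+1≡∸1+2 {suc j} _ = sym (+-suc j 1)

∣∸1∧∣+1⇒∣2 : ∀ {d k} → 0 < k → d ∣ k ∸ 1 → d ∣ k + 1 → d ∣ 2
∣∸1∧∣+1⇒∣2 {d} k>0 d∣k∸1 d∣k+1 = ∣m+n∣m⇒∣n (subst (d ∣_) (+1≡∸1+2 k>0) d∣k+1) d∣k∸1

¬2∣2n+1 : ∀ n → ¬ (2 ∣ 2 * n + 1)
¬2∣2n+1 n 2∣2n+1 = contradiction (∣1⇒≡1 (∣m+n∣m⇒∣n 2∣2n+1 (m∣m*n n))) λ ()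

twice-odd-multiple : ∀ {B c m n} → Coprime 2 B → m ≡ c * B → m ≡ (2 * n + 1) * 2 →
                     ∃[ a ] m ≡ 2 * B * a × ¬ (2 ∣ a)
twice-odd-multiple {B} {c} {m} {n} 2⊥B m≡cB m≡2[2n+1]
  with divides a refl ← coprime-divisor 2⊥B (divides (2 * n + 1) (trans (*-comm B c) (trans (sym m≡cB) m≡2[2n+1])))
  =
  a , trans m≡cB (solve (a ∷ B ∷ [])) , λ 2∣a → ¬2∣2n+1 n (subst (2 ∣_) aB≡2n+1 (∣m⇒∣m*n B 2∣a))
  where
  aB≡2n+1 : a * B ≡ 2 * n + 1
  aB≡2n+1 = *-cancelʳ-≡ (a * B) (2 * n + 1) 2 (trans reorder (trans (sym m≡cB) m≡2[2n+1]))
    where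
    reorder : a * B * 2 ≡ a * 2 * B
    reorder = solve (a ∷ B ∷ [])

+1≡twice-odd : ∀ {k b Q′} → 0 < k → k ∸ 1 ≡ b * (2 * (Q′ * 2)) → k + 1 ≡ (2 * (b * Q′) + 1) * 2
+1≡twice-odd {k} {b} {Q′} k>0 k∸1≡bG = begin
  k + 1                  ≡⟨ +1≡∸1+2 k>0 ⟩
  k ∸ 1 + 2              ≡⟨ cong (_+ 2) k∸1≡bG ⟩
  b * (2 * (Q′ * 2)) + 2 ≡⟨ solve (b ∷ Q′ ∷ []) ⟩
  (2 * (b * Q′) + 1) * 2 ∎
  where open ≡-Reasoning

quotients : ∀ {B Q k} → Coprime 2 B → 3 ∣ B → 2 ∣ Q → 0 < k → Solves B (2 * Q) k →
            ∃[ a ] ∃[ b ] (k + 1 ≡ 2 * B * a) × ¬ (2 ∣ a) × (k ∸ 1 ≡ 2 * Q * b) × ¬ (3 ∣ b)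
quotients {B} {_} {k} 2⊥B 3∣B (divides Q′ refl) k>0 (B∣k+1@(divides c k+1≡cB) , divides b k∸1≡bG)
  with a , k+1≡2Ba , 2∤a ←
         twice-odd-multiple {c = c} {n = b * Q′} 2⊥B k+1≡cB (+1≡twice-odd {b = b} {Q′} k>0 k∸1≡bG)
  =
  a , b , k+1≡2Ba , 2∤a , trans k∸1≡bG (*-comm b _) , 3∤b
  where
  3∤b : ¬ (3 ∣ b)
  3∤b 3∣b = contradiction (∣⇒≤ (∣∸1∧∣+1⇒∣2 k>0 3∣k∸1 (∣-trans 3∣B B∣k+1))) λ { (s≤s (s≤s ())) }
    where
    3∣k∸1 : 3 ∣ k ∸ 1
    3∣k∸1 = subst (3 ∣_) (sym k∸1≡bG) (∣m⇒∣m*n _ 3∣b)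

shifted-quotients : ∀ {B Q n k a b p q r} .{{_ : NonZero B}} .{{_ : NonZero Q}} → 0 < k →
                  p ≡ B * (2 * Q) * n + k → k + 1 ≡ 2 * B * a → k ∸ 1 ≡ 2 * Q * b →
                  p + 1 ≡ 2 * B * q → p ∸ 1 ≡ 2 * Q * r → q ≡ Q * n + a × r ≡ B * n + b
shifted-quotients {B} {Q} {n} {k} {a} {b} {p} {q} {r} k>0 p≡ k+1≡ k∸1≡ p+1≡ p∸1≡ =
  *-cancelˡ-≡ q (Q * n + a) (2 * B) {{m*n≢0 2 B}} 2Bq≡ ,
  *-cancelˡ-≡ r (B * n + b) (2 * Q) {{m*n≢0 2 Q}} 2Qr≡
  where
  open ≡-Reasoning
  2Bq≡ : 2 * B * q ≡ 2 * B * (Q * n + a)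
  2Bq≡ = begin
    2 * B * q                     ≡⟨ p+1≡ ⟨
    p + 1                         ≡⟨ cong (_+ 1) p≡ ⟩
    B * (2 * Q) * n + k + 1       ≡⟨ +-assoc (B * (2 * Q) * n) k 1 ⟩
    B * (2 * Q) * n + (k + 1)     ≡⟨ cong (B * (2 * Q) * n +_) k+1≡ ⟩
    B * (2 * Q) * n + 2 * B * a   ≡⟨ solve (B ∷ Q ∷ n ∷ a ∷ []) ⟩
    2 * B * (Q * n + a)           ∎
  2Qr≡ : 2 * Q * r ≡ 2 * Q * (B * n + b)
  2Qr≡ = begin
    2 * Q * r                     ≡⟨ p∸1≡ ⟨
    p ∸ 1                         ≡⟨ cong (_∸ 1) p≡ ⟩
    B * (2 * Q) * n + k ∸ 1       ≡⟨ +-∸-assoc (B * (2 * Q) * n) k>0 ⟩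
    B * (2 * Q) * n + (k ∸ 1)     ≡⟨ cong (B * (2 * Q) * n +_) k∸1≡ ⟩
    B * (2 * Q) * n + 2 * Q * b   ≡⟨ solve (B ∷ Q ∷ n ∷ b ∷ []) ⟩
    2 * Q * (B * n + b)           ∎

module Solution {B Q : ℕ} {{_ : NonZero Q}} (1<B : 1 < B)
                {x y : ℕ} (inverse : B * x ≡ 2 * Q * y + 1) where

  instance
    2Q≢0 : NonZero (2 * Q)
    2Q≢0 = m*n≢0 2 Q

  B⊥2Q : Coprime B (2 * Q)
  B⊥2Q = invertible⇒coprime inverse

  open Residues 1<B B⊥2Q public

  2⊥B : Coprime 2 B
  2⊥B = ⊥-sym (coprime-∣ʳ B⊥2Q (m∣m*n Q))

  k : ℕ
  k = (2 * (2 * Q * y) + 1) % (B * (2 * Q))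

  k-solves : Solves B (2 * Q) k
  k-solves = solves-% (solves-from-inverse inverse)

  k<M : k < B * (2 * Q)
  k<M = m%n<n _ (B * (2 * Q))

  k>0 : 0 < k
  k>0 = ∣+1⇒>0 (proj₁ k-solves)

  solution-decomposition : ∀ {a b p q r} → k + 1 ≡ 2 * B * a → k ∸ 1 ≡ 2 * Q * b →
                           p + 1 ≡ 2 * B * q → p ∸ 1 ≡ 2 * Q * r →
                           ∃[ n ] (p ≡ B * (2 * Q) * n + k) × (q ≡ Q * n + a) × (r ≡ B * n + b)
  solution-decomposition {p = p} {q} {r} k+1≡ k∸1≡ p+1≡ p∸1≡ =
    p / (B * (2 * Q)) , p≡ , shifted-quotients k>0 p≡ k+1≡ k∸1≡ p+1≡ p∸1≡
    where
    p-solves : Solves B (2 * Q) p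
    p-solves = divides (2 * q) (trans p+1≡ (solve (B ∷ q ∷ []))) ,
               divides r (trans p∸1≡ (*-comm (2 * Q) r))
    p≡ : p ≡ B * (2 * Q) * (p / (B * (2 * Q))) + k
    p≡ = solves⇒≡mod k-solves k<M p-solves

lemma3p4 : (β γ : ℕ) → 1 ≤ β → 2 ≤ γ →
    Σ ℕ λ k → IsSol β γ k × (∀ k′ → IsSol β γ k′ → k′ ≡ k) ×
      (∃[ a ] ∃[ b ]
        (k + 1 ≡ 2 * 3 ^ β * a) × ¬ (2 ∣ a) ×
        (k ∸ 1 ≡ 2 ^ γ * b) × ¬ (3 ∣ b) ×
        (∀ p q r → InA p → Prime q → Prime r → Coprime 6 (q * r) →
          p + 1 ≡ 2 * 3 ^ β * q → p ∸ 1 ≡ 2 ^ γ * r →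
          ∃[ n ] (p ≡ 3 ^ β * 2 ^ γ * n + k) ×
                 (q ≡ 2 ^ (γ ∸ 1) * n + a) × (r ≡ 3 ^ β * n + b)))
lemma3p4 (suc β) (suc (suc γ)) (s≤s z≤n) (s≤s (s≤s z≤n))
  with x , y , inverse ← odd-invertible-mod-2^ (3^-odd (suc β)) (suc γ) =
  let a , b , k+1≡2Ba , 2∤a , k∸1≡Gb , 3∤b = quotients 2⊥B (m∣m*n (3 ^ β)) (m∣m*n (2 ^ γ)) k>0 k-solves
  in k , (k>0 , k<M , k-solves) ,
     (λ _ (_ , k′<M , k′-solves) → solves-unique k′-solves k-solves k′<M k<M) ,
     a , b , k+1≡2Ba , 2∤a , k∸1≡Gb , 3∤b ,
     λ _ _ _ _ _ _ _ → solution-decomposition k+1≡2Ba k∸1≡Gb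
  where
  instance
    2^≢0 : NonZero (2 ^ suc γ)
    2^≢0 = m^n≢0 2 (suc γ)
  open Solution {Q = 2 ^ suc γ} (^-monoʳ-< 3 (s≤s (s≤s z≤n)) {0} {suc β} z<s) inverse
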